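{- Let $m\in\mathbb{Z}\setminus\{0\}$ and $\Delta=m(m-4)$, and let $p$ be an odd prime with $p\nmid\Delta$. Then $$\sum_{k=1}^{p-1}\binom{p}{k}u_k(m-2,1)\equiv\left(\frac{\Delta}{p}\right)\frac{m^{p-1}-1}{2}+\frac{4-m}{4}u_{p-(\frac{\Delta}{p})}(m-2,1)\pmod{p^2}$$ and $$\sum_{k=1}^{p-1}\binom{p}{k}v_k(m-2,1)\equiv\frac m2(m^{p-1}-1)-\frac{\Delta}{4}\left(\frac{\Delta}{p}\right)u_{p-(\frac{\Delta}{p})}(m-2,1)\pmod{p^2}.$$
   Context: For integers $A,B$, $u_0(A,B)=0$, $u_1(A,B)=1$, $u_{n+1}(A,B)=Au_n(A,B)-Bu_{n-1}(A,B)$, and $v_0(A,B)=2$, $v_1(A,B)=A$, $v_{n+1}(A,B)=Av_n(A,B)-Bv_{n-1}(A,B)$ for $n\ge1$. $\left(\frac{\Delta}{p}\right)$ is the Legendre symbol. For rational numbers $a,b$, $a\equiv b\pmod{p^2}$ means $a-b\in p^2\mathbb{Z}_p$, with $\mathbb{Z}_p$ the ring of $p$-adic integers. -}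

module Defs where

open import Data.Nat as ℕ using (ℕ; zero; suc)
open import Data.Nat.Combinatorics using (_C_)
open import Data.Integer as ℤ using (ℤ; +_; -[1+_])
open import Data.Integer.Divisibility using () renaming (_∣_ to _∣ℤ_)
open import Data.Nat.Divisibility using (_∣?_)
open import Data.Rational as ℚ using (ℚ; ↥_)
open import Data.List using (List; map; foldr; upTo)
open import Data.Bool.ListAction using (any)
open import Data.Bool using (Bool; true; false; if_then_else_)
open import Relation.Nullary.Decidable using (⌊_⌋; does)

private
  step : ℤ → ℤ → ℤ → ℤ → ℤ
  step A B x y = ℤ._-_ (ℤ._*_ A y) (ℤ._*_ B x)

  lucasPair : ℤ → ℤ → ℤ → ℤ → ℕ → ℤ
  lucasPair A B x y zero    = x
  lucasPair A B x y (suc n) = lucasPair A B y (step A B x y) n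

u : ℤ → ℤ → ℕ → ℤ
u A B n = lucasPair A B (+ 0) (+ 1) n

v : ℤ → ℤ → ℕ → ℤ
v A B n = lucasPair A B (+ 2) A n

_∣ℤ?_ : ℕ → ℤ → Bool
p ∣ℤ? a = ⌊ p ∣? ℤ.∣ a ∣ ⌋

isQR : ℤ → ℕ → Bool
isQR a p = any (λ x → p ∣ℤ? ℤ._-_ (ℤ._*_ (+ x) (+ x)) a) (upTo p)

legendre : ℤ → ℕ → ℤ
legendre a p =
  if p ∣ℤ? a then + 0
  else (if isQR a p then + 1 else -[1+ 0 ])

sumFromTo : ℕ → ℕ → (ℕ → ℤ) → ℤ
sumFromTo a b f = foldr ℤ._+_ (+ 0) (map (λ i → f (a ℕ.+ i)) (upTo (suc b ℕ.∸ a)))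

-- For rationals x, y: x ≡ y (mod n) means x - y ∈ n ℤ_p; with n = p² and
-- x - y written in lowest terms r/s, this holds iff p² divides the numerator r.
_≡_[modℚ_] : ℚ → ℚ → ℕ → Set
x ≡ y [modℚ n ] = (+ n) ∣ℤ (↥ (x ℚ.- y))

toℚ : ℤ → ℚ
toℚ z = z ℚ./ 1

-- Write p = 2k + 1, A = m − 2 (so that Δ = A² − 4), a = Uₖ, b = Uₖ₊₁ and X = mᵏ, where
-- U, V are the Lucas sequences of (A, 1).  On solutions of x(n+2) = A x(n+1) − x(n) the shift E
-- satisfies (1 + E)² = m E, so the two binomial sums are exactly X(a + b) − Uₚ and
-- X(Vₖ + Vₖ₊₁) − 2 − Vₚ, with Uₚ = b² − a², Uₚ₋₁ = a Vₖ, Uₚ₊₁ = b Vₖ₊₁ and m^(p−1) = X².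
-- Modulo p, the binomial theorem and Fermat give Uₚ ≡ Δᵏ, Vₚ ≡ A and X(a + b) ≡ Uₚ, and Euler's
-- criterion gives Δᵏ ≡ (Δ/p).  Together with Cassini's identity b² − A a b + a² = 1 this forces
-- p ∣ a and X ≡ b when (Δ/p) = 1, and p ∣ b and X ≡ −a when (Δ/p) = −1.  Four times the
-- difference of the two sides of each congruence is then a quadratic form in two multiples of p
-- plus a multiple of b² − A a b + a² − 1, hence divisible by p².

module Submission where

open import Defs
open import Algebra.Properties.CommutativeSemigroup using (interchange)
open import Data.Bool using (T; true; false)
open import Data.Integer as ℤ using (ℤ; +_; -[1+_]; _+_; _*_; _-_; -_; _^_)
import Data.Integer.Coprimality as ℤC
open import Data.Integer.Divisibility using () renaming (_∣_ to _∣ℤ_)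
open import Data.Integer.Divisibility.Signed
  using (_∣_; divides; ∣-refl; ∣-trans; ∣ᵤ⇒∣; ∣⇒∣ᵤ; ∣m∣n⇒∣m+n; ∣m∣n⇒∣m-n; ∣m+n∣m⇒∣n; ∣m+n∣n⇒∣m;
         ∣m⇒∣-m; ∣n⇒∣m*n; ∣m⇒∣m*n; *-monoˡ-∣; *-monoʳ-∣)
import Data.Integer.Properties as ℤP
open import Data.Integer.Tactic.RingSolver using (solve-∀)
open import Data.List using (foldr; map; applyUpTo; upTo)
open import Data.List.Relation.Unary.Any.Properties using (any⁺; any⁻; applyUpTo⁺; applyUpTo⁻)
open import Data.Nat as ℕ using (ℕ; zero; suc; _≤_; _<_; z≤n; s≤s)
open import Data.Nat.Combinatorics using (_C_; nCk+nC[k+1]≡[n+1]C[k+1])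
import Data.Nat.Coprimality as ℕC
import Data.Nat.Divisibility as ℕD
open import Data.Nat.Primality using (Prime; euclidsLemma; prime⇒irreducible; ¬prime[1])
import Data.Nat.Properties as ℕP
open import Data.Product using (_×_; _,_; proj₁; proj₂; ∃-syntax; uncurry)
open import Data.Rational as ℚ using (ℚ; ↥_; ↧_)
import Data.Rational.Properties as ℚP
open import Data.Rational.Unnormalised as ℚᵘ using (ℚᵘ; mkℚᵘ; *≡*; _≃_)
import Data.Rational.Unnormalised.Properties as ℚᵘP
open import Data.Sum using (_⊎_; inj₁; inj₂; [_,_]′)
open import Data.Vec using (Vec; []; _∷_)
open import Function using (id; _∘_)
open import Relation.Binary.Bundles using (Setoid)
open import Relation.Binary.PropositionalEquality
open import Relation.Binary.Structures using (IsEquivalence)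
open import Relation.Nullary using (¬_; yes; no; contradiction)
open import Relation.Nullary.Decidable using (toWitness; fromWitness)

-- Sums and congruences

∑ : ℕ → (ℕ → ℤ) → ℤ
∑ zero    f = + 0
∑ (suc n) f = f 0 + ∑ n (f ∘ suc)

∑-cong : ∀ n {f g : ℕ → ℤ} → (∀ i → f i ≡ g i) → ∑ n f ≡ ∑ n g
∑-cong zero    f≗g = refl
∑-cong (suc n) f≗g = cong₂ _+_ (f≗g 0) (∑-cong n (f≗g ∘ suc))

∑-distrib-+ : ∀ n (f g : ℕ → ℤ) → ∑ n (λ i → f i + g i) ≡ ∑ n f + ∑ n g
∑-distrib-+ zero    f g = refl
∑-distrib-+ (suc n) f g =
  trans (cong (_+_ (f 0 + g 0)) (∑-distrib-+ n (f ∘ suc) (g ∘ suc))) (interchange ℤP.+-commutativeSemigroup (f 0) (g 0) _ _)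

∑-distribˡ-* : ∀ n c (f : ℕ → ℤ) → ∑ n (λ i → c * f i) ≡ c * ∑ n f
∑-distribˡ-* zero    c f = sym (ℤP.*-zeroʳ c)
∑-distribˡ-* (suc n) c f =
  trans (cong (_+_ (c * f 0)) (∑-distribˡ-* n c (f ∘ suc))) (sym (ℤP.*-distribˡ-+ c (f 0) _))

∑-last : ∀ n (f : ℕ → ℤ) → ∑ (suc n) f ≡ ∑ n f + f n
∑-last zero    f = ℤP.+-comm (f 0) (+ 0)
∑-last (suc n) f = trans (cong (_+_ (f 0)) (∑-last n (f ∘ suc))) (sym (ℤP.+-assoc (f 0) _ _))

∣-∑ : ∀ {d} n (f : ℕ → ℤ) → (∀ i → i < n → d ∣ f i) → d ∣ ∑ n f
∣-∑ zero    f d∣f = divides (+ 0) refl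
∣-∑ (suc n) f d∣f = ∣m∣n⇒∣m+n (d∣f 0 (s≤s z≤n)) (∣-∑ n (f ∘ suc) (λ i i<n → d∣f (suc i) (s≤s i<n)))

foldr-+-map-applyUpTo : ∀ n (f : ℕ → ℤ) (g : ℕ → ℕ) →
                        foldr _+_ (+ 0) (map f (applyUpTo g n)) ≡ ∑ n (f ∘ g)
foldr-+-map-applyUpTo zero    f g = refl
foldr-+-map-applyUpTo (suc n) f g = cong (_+_ (f (g 0))) (foldr-+-map-applyUpTo n f (g ∘ suc))

infix 4 _≡_[mod_]

record _≡_[mod_] (a b : ℤ) (n : ℕ) : Set where
  constructor ∣⇒≡-mod
  field ≡-mod⇒∣ : + n ∣ a - b
open _≡_[mod_] public

module _ {n : ℕ} where

  private
    minus-trans : ∀ a b c → a - c ≡ (a - b) + (b - c)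
    minus-trans = solve-∀
    minus-sym : ∀ a b → b - a ≡ - (a - b)
    minus-sym = solve-∀
    minus-+ : ∀ a b c d → (a + c) - (b + d) ≡ (a - b) + (c - d)
    minus-+ = solve-∀
    minus-* : ∀ a b c d → a * c - b * d ≡ (a - b) * c + b * (c - d)
    minus-* = solve-∀
    minus-+-cancel : ∀ a b c → (c + a) - (c + b) ≡ a - b
    minus-+-cancel = solve-∀

  ≡-mod-reflexive : ∀ {a b} → a ≡ b → a ≡ b [mod n ]
  ≡-mod-reflexive {a} refl = ∣⇒≡-mod (divides (+ 0) (ℤP.+-inverseʳ a))

  ≡-mod-refl : ∀ {a} → a ≡ a [mod n ]
  ≡-mod-refl = ≡-mod-reflexive refl

  ≡-mod-sym : ∀ {a b} → a ≡ b [mod n ] → b ≡ a [mod n ]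
  ≡-mod-sym {a} {b} (∣⇒≡-mod a≡b) = ∣⇒≡-mod (subst (+ n ∣_) (sym (minus-sym a b)) (∣m⇒∣-m a≡b))

  ≡-mod-trans : ∀ {a b c} → a ≡ b [mod n ] → b ≡ c [mod n ] → a ≡ c [mod n ]
  ≡-mod-trans {a} {b} {c} (∣⇒≡-mod a≡b) (∣⇒≡-mod b≡c) =
    ∣⇒≡-mod (subst (+ n ∣_) (sym (minus-trans a b c)) (∣m∣n⇒∣m+n a≡b b≡c))

  ≡-mod-isEquivalence : IsEquivalence (λ a b → a ≡ b [mod n ])
  ≡-mod-isEquivalence = record { refl = ≡-mod-refl ; sym = ≡-mod-sym ; trans = ≡-mod-trans }

  +-cong-mod : ∀ {a b c d} → a ≡ b [mod n ] → c ≡ d [mod n ] → a + c ≡ b + d [mod n ]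
  +-cong-mod {a} {b} {c} {d} (∣⇒≡-mod a≡b) (∣⇒≡-mod c≡d) =
    ∣⇒≡-mod (subst (+ n ∣_) (sym (minus-+ a b c d)) (∣m∣n⇒∣m+n a≡b c≡d))

  *-cong-mod : ∀ {a b c d} → a ≡ b [mod n ] → c ≡ d [mod n ] → a * c ≡ b * d [mod n ]
  *-cong-mod {a} {b} {c} {d} (∣⇒≡-mod a≡b) (∣⇒≡-mod c≡d) =
    ∣⇒≡-mod (subst (+ n ∣_) (sym (minus-* a b c d)) (∣m∣n⇒∣m+n (∣m⇒∣m*n c a≡b) (∣n⇒∣m*n b c≡d)))

  +-congˡ-mod : ∀ c {a b} → a ≡ b [mod n ] → c + a ≡ c + b [mod n ]
  +-congˡ-mod c = +-cong-mod (≡-mod-refl {c})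

  +-congʳ-mod : ∀ c {a b} → a ≡ b [mod n ] → a + c ≡ b + c [mod n ]
  +-congʳ-mod c a≡b = +-cong-mod a≡b (≡-mod-refl {c})

  *-congˡ-mod : ∀ c {a b} → a ≡ b [mod n ] → c * a ≡ c * b [mod n ]
  *-congˡ-mod c = *-cong-mod (≡-mod-refl {c})

  *-congʳ-mod : ∀ c {a b} → a ≡ b [mod n ] → a * c ≡ b * c [mod n ]
  *-congʳ-mod c a≡b = *-cong-mod a≡b (≡-mod-refl {c})

  ^-cong-mod : ∀ {a b} k → a ≡ b [mod n ] → a ^ k ≡ b ^ k [mod n ]
  ^-cong-mod zero    a≡b = ≡-mod-refl
  ^-cong-mod (suc k) a≡b = *-cong-mod a≡b (^-cong-mod k a≡b)

  +-cancelˡ-mod : ∀ c {a b} → c + a ≡ c + b [mod n ] → a ≡ b [mod n ]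
  +-cancelˡ-mod c {a} {b} (∣⇒≡-mod ca≡cb) = ∣⇒≡-mod (subst (+ n ∣_) (minus-+-cancel a b c) ca≡cb)

  ∣⇒≡0-mod : ∀ {a} → + n ∣ a → a ≡ + 0 [mod n ]
  ∣⇒≡0-mod {a} n∣a = ∣⇒≡-mod (subst (+ n ∣_) (sym (ℤP.+-identityʳ a)) n∣a)

≡-mod-setoid : ℕ → Setoid _ _
≡-mod-setoid n = record { isEquivalence = ≡-mod-isEquivalence {n} }

module ≡-mod-Reasoning (n : ℕ) where
  open import Relation.Binary.Reasoning.Setoid (≡-mod-setoid n) public

euclidsLemmaℤ : ∀ {p} → Prime p → ∀ a b → + p ∣ a * b → + p ∣ a ⊎ + p ∣ b
euclidsLemmaℤ {p} pp a b p∣ab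
  with euclidsLemma ℤ.∣ a ∣ ℤ.∣ b ∣ pp (subst (p ℕD.∣_) (ℤP.abs-* a b) (∣⇒∣ᵤ p∣ab))
... | inj₁ p∣a = inj₁ (∣ᵤ⇒∣ p∣a)
... | inj₂ p∣b = inj₂ (∣ᵤ⇒∣ p∣b)

prime∣*-cancelˡ : ∀ {p} → Prime p → ∀ {a b} → ¬ + p ∣ a → + p ∣ a * b → + p ∣ b
prime∣*-cancelˡ pp {a} {b} p∤a p∣ab with euclidsLemmaℤ pp a b p∣ab
... | inj₁ p∣a = contradiction p∣a p∤a
... | inj₂ p∣b = p∣b

*-cancelˡ-mod : ∀ {p} → Prime p → ∀ c {a b} → ¬ + p ∣ c → c * a ≡ c * b [mod p ] → a ≡ b [mod p ]
*-cancelˡ-mod {p} pp c {a} {b} p∤c (∣⇒≡-mod p∣ca-cb) =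
  ∣⇒≡-mod (prime∣*-cancelˡ pp p∤c (subst (+ p ∣_) (factor c a b) p∣ca-cb))
  where
  factor : ∀ c a b → c * a - c * b ≡ c * (a - b)
  factor = solve-∀

>⇒∤ℤ : ∀ {p n} .{{_ : ℕ.NonZero n}} → n < p → ¬ + p ∣ + n
>⇒∤ℤ n<p = ℕD.>⇒∤ n<p ∘ ∣⇒∣ᵤ

odd-prime>2 : ∀ {k} → Prime (suc (k ℕ.+ k)) → 2 < suc (k ℕ.+ k)
odd-prime>2 {zero}   pp = contradiction pp ¬prime[1]
odd-prime>2 {suc k′} pp = s≤s (s≤s (ℕP.≤-trans (s≤s z≤n) (ℕP.m≤n+m (suc k′) k′)))

odd-prime∤2 : ∀ {k} → Prime (suc (k ℕ.+ k)) → ¬ + suc (k ℕ.+ k) ∣ + 2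
odd-prime∤2 {k} pp = >⇒∤ℤ (odd-prime>2 {k} pp)

halve : ∀ n → ∃[ k ] (n ≡ k ℕ.+ k ⊎ n ≡ suc (k ℕ.+ k))
halve zero    = 0 , inj₁ refl
halve (suc n) with halve n
... | k , inj₁ n≡k+k   = k , inj₂ (cong suc n≡k+k)
... | k , inj₂ n≡1+k+k = suc k , inj₁ (trans (cong suc n≡1+k+k) (sym (ℕP.+-suc (suc k) k)))

odd-prime : ∀ {p} → Prime p → p ≢ 2 → ∃[ k ] p ≡ suc (k ℕ.+ k)
odd-prime {p} pp p≢2 with halve p
... | k , inj₂ p≡1+k+k = k , p≡1+k+k
... | k , inj₁ p≡k+k
  with prime⇒irreducible pp (ℕD.divides k (trans p≡k+k (sym (trans (ℕP.*-suc k 1) (cong (k ℕ.+_) (ℕP.*-identityʳ k))))))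
...   | inj₁ ()
...   | inj₂ 2≡p = contradiction (sym 2≡p) p≢2

coprime-*ʳ : ∀ {m a b} → ℕC.Coprime m a → ℕC.Coprime m b → ℕC.Coprime m (a ℕ.* b)
coprime-*ʳ m⊥a m⊥b (i∣m , i∣ab) =
  m⊥b (i∣m , ℕC.coprime-divisor (λ (j∣i , j∣a) → m⊥a (ℕD.∣-trans j∣i i∣m , j∣a)) i∣ab)

odd-prime-square⊥4 : ∀ {k} → Prime (suc (k ℕ.+ k)) → ℕC.Coprime (suc (k ℕ.+ k) ℕ.* suc (k ℕ.+ k)) 4
odd-prime-square⊥4 {k} pp = ℕC.sym (coprime-*ʳ (ℕC.sym p⊥4) (ℕC.sym p⊥4))
  where
  p⊥2 : ℕC.Coprime (suc (k ℕ.+ k)) 2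
  p⊥2 = ℕC.prime⇒coprime pp (odd-prime>2 {k} pp)
  p⊥4 : ℕC.Coprime (suc (k ℕ.+ k)) 4
  p⊥4 = coprime-*ʳ p⊥2 p⊥2

-- Binomial transforms and Fermat's little theorem

-- binomial c n i is the coefficient of Xⁱ in (c + X)ⁿ, that is C(n,i)·cⁿ⁻ⁱ.
binomial : ℤ → ℕ → ℕ → ℤ
binomial c zero    zero    = + 1
binomial c zero    (suc i) = + 0
binomial c (suc n) zero    = c * binomial c n zero
binomial c (suc n) (suc i) = binomial c n i + c * binomial c n (suc i)

binomial-zero : ∀ c n → binomial c n 0 ≡ c ^ n
binomial-zero c zero    = refl
binomial-zero c (suc n) = cong (c *_) (binomial-zero c n)

binomial-above : ∀ c {n i} → n < i → binomial c n i ≡ + 0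
binomial-above c {zero}  {suc i} _         = refl
binomial-above c {suc n} {suc i} (s≤s n<i) =
  trans (cong₂ (λ x y → x + c * y) (binomial-above c n<i) (binomial-above c (ℕP.m<n⇒m<1+n n<i)))
        (trans (ℤP.+-identityˡ _) (ℤP.*-zeroʳ c))

binomial-diag : ∀ c n → binomial c n n ≡ + 1
binomial-diag c zero = refl
binomial-diag c (suc n) =
  trans (cong₂ (λ x y → x + c * y) (binomial-diag c n) (binomial-above c (ℕP.n<1+n n)))
        (cong (_+_ (+ 1)) (ℤP.*-zeroʳ c))

binomial-one : ∀ n i → binomial (+ 1) n i ≡ + (n C i)
binomial-one zero    zero    = refl
binomial-one zero    (suc i) = refl
binomial-one (suc n) zero    = trans (ℤP.*-identityˡ _) (binomial-one n 0)
binomial-one (suc n) (suc i) =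
  trans (cong₂ _+_ (binomial-one n i) (trans (ℤP.*-identityˡ _) (binomial-one n (suc i))))
        (cong +_ (nCk+nC[k+1]≡[n+1]C[k+1] n i))

binomial-absorb : ∀ c n i → + suc i * binomial c (suc n) (suc i) ≡ + suc n * binomial c n i
binomial-absorb c zero zero    rewrite ℤP.*-zeroʳ c = refl
binomial-absorb c zero (suc i) rewrite ℤP.*-zeroʳ c = ℤP.*-zeroʳ (+ suc (suc i))
binomial-absorb c (suc n) zero = begin
  + 1 * (c * β + c * γ)         ≡⟨ ℤP.*-identityˡ _ ⟩
  c * β + c * γ                 ≡⟨ cong (λ g → c * β + c * g) γ≡ ⟩
  c * β + c * (+ suc n * β)     ≡⟨ regroup c β (+ suc n) ⟩
  + suc (suc n) * (c * β)       ∎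
  where
  open ≡-Reasoning
  β = binomial c n 0
  γ = binomial c (suc n) 1
  γ≡ : γ ≡ + suc n * β
  γ≡ = trans (sym (ℤP.*-identityˡ γ)) (binomial-absorb c n 0)
  regroup : ∀ c β N → c * β + c * (N * β) ≡ (+ 1 + N) * (c * β)
  regroup = solve-∀
binomial-absorb c (suc n) (suc i) = begin
  (+ 1 + I) * (β + c * γ)                 ≡⟨ regroup c β γ I ⟩
  β + I * β + c * ((+ 1 + I) * γ)        ≡⟨ cong₂ (λ x y → β + x + c * y)
                                              (binomial-absorb c n i) (binomial-absorb c n (suc i)) ⟩
  β + N * δ + c * (N * ε)                ≡⟨ regroup′ δ ε c N ⟩
  (+ 1 + N) * (δ + c * ε)                ∎
  where
  open ≡-Reasoning
  I = + suc i
  N = + suc n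
  β = binomial c (suc n) (suc i)
  γ = binomial c (suc n) (suc (suc i))
  δ = binomial c n i
  ε = binomial c n (suc i)
  regroup : ∀ c β γ I → (+ 1 + I) * (β + c * γ) ≡ β + I * β + c * ((+ 1 + I) * γ)
  regroup = solve-∀
  regroup′ : ∀ δ ε c N → (δ + c * ε) + N * δ + c * (N * ε) ≡ (+ 1 + N) * (δ + c * ε)
  regroup′ = solve-∀

prime∣binomial : ∀ {p} c → Prime p → ∀ i → 0 < i → i < p → + p ∣ binomial c p i
prime∣binomial {suc q} c pp (suc i) _ i<p =
  prime∣*-cancelˡ pp (>⇒∤ℤ i<p) (subst (+ suc q ∣_) (sym (binomial-absorb c q i)) (∣m⇒∣m*n _ ∣-refl))

-- transform c n x j is the j-th term of (c + E)ⁿ x, where E is the shift x ↦ x ∘ suc.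
transform : ℤ → ℕ → (ℕ → ℤ) → ℕ → ℤ
transform c n x j = ∑ (suc n) (λ i → binomial c n i * x (i ℕ.+ j))

transform-suc : ∀ c n x j → transform c (suc n) x j ≡ c * transform c n x j + transform c n x (suc j)
transform-suc c n x j = begin
  c * β₀ * x j + ∑ (suc n) (λ i → (binomial c n i + c * binomial c n (suc i)) * x (suc i ℕ.+ j))
    ≡⟨ cong (_+_ (c * β₀ * x j)) (∑-cong (suc n) split) ⟩
  c * β₀ * x j + ∑ (suc n) (λ i → lower i + c * upper i)
    ≡⟨ cong (_+_ (c * β₀ * x j)) (trans (∑-distrib-+ (suc n) lower (λ i → c * upper i))
                                        (cong (_+_ (∑ (suc n) lower)) (∑-distribˡ-* (suc n) c upper))) ⟩
  c * β₀ * x j + (transform c n x (suc j) + c * ∑ (suc n) upper)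
    ≡⟨ cong (λ s → c * β₀ * x j + (transform c n x (suc j) + c * s)) upper-last ⟩
  c * β₀ * x j + (transform c n x (suc j) + c * ∑ n upper)
    ≡⟨ regroup c β₀ (x j) (transform c n x (suc j)) (∑ n upper) ⟩
  c * transform c n x j + transform c n x (suc j) ∎
  where
  open ≡-Reasoning
  β₀ = binomial c n 0
  lower upper : ℕ → ℤ
  lower i = binomial c n i * x (i ℕ.+ suc j)
  upper i = binomial c n (suc i) * x (suc i ℕ.+ j)
  split : ∀ i → (binomial c n i + c * binomial c n (suc i)) * x (suc i ℕ.+ j) ≡ lower i + c * upper i
  split i = trans (distrib (binomial c n i) (binomial c n (suc i)) c (x (suc i ℕ.+ j)))
                  (cong (λ k → binomial c n i * x k + c * upper i) (sym (ℕP.+-suc i j)))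
    where
    distrib : ∀ β γ c y → (β + c * γ) * y ≡ β * y + c * (γ * y)
    distrib = solve-∀
  upper-last : ∑ (suc n) upper ≡ ∑ n upper
  upper-last = begin
    ∑ (suc n) upper                   ≡⟨ ∑-last n upper ⟩
    ∑ n upper + upper n               ≡⟨ cong (λ β → ∑ n upper + β * x (suc n ℕ.+ j)) (binomial-above c (ℕP.n<1+n n)) ⟩
    ∑ n upper + + 0 * x (suc n ℕ.+ j) ≡⟨ cong (_+_ (∑ n upper)) (ℤP.*-zeroˡ (x (suc n ℕ.+ j))) ⟩
    ∑ n upper + + 0                   ≡⟨ ℤP.+-identityʳ _ ⟩
    ∑ n upper                         ∎
  regroup : ∀ c β y T S → c * β * y + (T + c * S) ≡ c * (β * y + S) + T
  regroup = solve-∀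

transform-cong : ∀ c n {x y : ℕ → ℤ} → (∀ i → x i ≡ y i) → ∀ j → transform c n x j ≡ transform c n y j
transform-cong c n x≗y j = ∑-cong (suc n) (λ i → cong (binomial c n i *_) (x≗y (i ℕ.+ j)))

transform-shift : ∀ c n x j → transform c n (x ∘ suc) j ≡ transform c n x (suc j)
transform-shift c n x j = ∑-cong (suc n) (λ i → cong (λ k → binomial c n i * x k) (sym (ℕP.+-suc i j)))

transform-+ : ∀ c n x y j → transform c n (λ i → x i + y i) j ≡ transform c n x j + transform c n y j
transform-+ c n x y j =
  trans (∑-cong (suc n) (λ i → ℤP.*-distribˡ-+ (binomial c n i) (x (i ℕ.+ j)) (y (i ℕ.+ j))))
        (∑-distrib-+ (suc n) (λ i → binomial c n i * x (i ℕ.+ j)) (λ i → binomial c n i * y (i ℕ.+ j)))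

transform-*ˡ : ∀ c n a x j → transform c n (λ i → a * x i) j ≡ a * transform c n x j
transform-*ˡ c n a x j =
  trans (∑-cong (suc n) (λ i → swap (binomial c n i) a (x (i ℕ.+ j))))
        (∑-distribˡ-* (suc n) a (λ i → binomial c n i * x (i ℕ.+ j)))
  where
  swap : ∀ β a y → β * (a * y) ≡ a * (β * y)
  swap = solve-∀

transform-prime : ∀ {p} c x j → Prime p → transform c p x j ≡ c ^ p * x j + x (p ℕ.+ j) [mod p ]
transform-prime {p@(suc q)} c x j pp = begin
  binomial c p 0 * x j + ∑ p upper
    ≡⟨ cong (_+_ (binomial c p 0 * x j)) (∑-last q upper) ⟩
  binomial c p 0 * x j + (∑ q upper + upper q)
    ≈⟨ +-congˡ-mod (binomial c p 0 * x j) (+-congʳ-mod (upper q) (∣⇒≡0-mod middle)) ⟩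
  binomial c p 0 * x j + (+ 0 + upper q)
    ≡⟨ cong₂ (λ β γ → β * x j + γ) (binomial-zero c p) (trans (ℤP.+-identityˡ _) top) ⟩
  c ^ p * x j + x (p ℕ.+ j) ∎
  where
  open ≡-mod-Reasoning p
  upper : ℕ → ℤ
  upper i = binomial c p (suc i) * x (suc i ℕ.+ j)
  middle : + p ∣ ∑ q upper
  middle = ∣-∑ q upper (λ i i<q → ∣m⇒∣m*n _ (prime∣binomial c pp (suc i) (s≤s z≤n) (s≤s i<q)))
  top : upper q ≡ x (p ℕ.+ j)
  top = trans (cong (_* x (p ℕ.+ j)) (binomial-diag c p)) (ℤP.*-identityˡ _)

transform-powers : ∀ a n j → transform (+ 1) n (a ^_) j ≡ a ^ j * (+ 1 + a) ^ n
transform-powers a zero    j = unit (a ^ j)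
  where
  unit : ∀ y → + 1 * y + + 0 ≡ y * + 1
  unit = solve-∀
transform-powers a (suc n) j = begin
  transform (+ 1) (suc n) (a ^_) j
    ≡⟨ transform-suc (+ 1) n (a ^_) j ⟩
  + 1 * transform (+ 1) n (a ^_) j + transform (+ 1) n (a ^_) (suc j)
    ≡⟨ cong₂ (λ s t → + 1 * s + t) (transform-powers a n j) (transform-powers a n (suc j)) ⟩
  + 1 * (a ^ j * (+ 1 + a) ^ n) + a * a ^ j * (+ 1 + a) ^ n
    ≡⟨ regroup a (a ^ j) ((+ 1 + a) ^ n) ⟩
  a ^ j * (+ 1 + a) ^ suc n ∎
  where
  open ≡-Reasoning
  regroup : ∀ a y z → + 1 * (y * z) + a * y * z ≡ y * ((+ 1 + a) * z)
  regroup = solve-∀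

module _ {p} (pp : Prime p) where

  freshman's-dream : ∀ a → (+ 1 + a) ^ p ≡ + 1 + a ^ p [mod p ]
  freshman's-dream a = begin
    (+ 1 + a) ^ p                  ≡⟨ ℤP.*-identityˡ _ ⟨
    + 1 * (+ 1 + a) ^ p            ≡⟨ transform-powers a p 0 ⟨
    transform (+ 1) p (a ^_) 0     ≈⟨ transform-prime (+ 1) (a ^_) 0 pp ⟩
    (+ 1) ^ p * + 1 + a ^ (p ℕ.+ 0) ≡⟨ cong₂ (λ u k → u * + 1 + a ^ k) (ℤP.^-zeroˡ p) (ℕP.+-identityʳ p) ⟩
    + 1 + a ^ p                    ∎
    where open ≡-mod-Reasoning p

  fermat : ∀ a → a ^ p ≡ a [mod p ]
  fermat (+ zero)         = ≡-mod-reflexive (zero^prime pp)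
    where
    zero^prime : ∀ {p} → Prime p → (+ 0) ^ p ≡ + 0
    zero^prime {suc q} _ = ℤP.*-zeroˡ ((+ 0) ^ q)
  fermat (+ suc n)        = ≡-mod-trans (freshman's-dream (+ n)) (+-congˡ-mod (+ 1) (fermat (+ n)))
  fermat -[1+ zero ]      = +-cancelˡ-mod (+ 1) (≡-mod-trans (≡-mod-sym (freshman's-dream -[1+ 0 ])) (fermat (+ 0)))
  fermat -[1+ suc n ]     = +-cancelˡ-mod (+ 1) (≡-mod-trans (≡-mod-sym (freshman's-dream -[1+ suc n ])) (fermat -[1+ n ]))

fermat-unit : ∀ {q} → Prime (suc q) → ∀ a → ¬ + suc q ∣ a → a ^ q ≡ + 1 [mod suc q ]
fermat-unit {q} pp a p∤a =
  ∣⇒≡-mod (prime∣*-cancelˡ pp p∤a (subst (+ suc q ∣_) (factor a (a ^ q)) (≡-mod⇒∣ (fermat pp a))))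
  where
  factor : ∀ a y → a * y - a ≡ a * (y - + 1)
  factor = solve-∀

sumFromTo-binomial : ∀ q (x : ℕ → ℤ) →
  sumFromTo 1 q (λ j → + (suc q C j) * x j) ≡ transform (+ 1) (suc q) x 0 - x 0 - x (suc q)
sumFromTo-binomial q x = begin
  sumFromTo 1 q (λ j → + (p C j) * x j)    ≡⟨ foldr-+-map-applyUpTo q middle id ⟩
  ∑ q middle                               ≡⟨ isolate (x 0) (∑ q middle) (x p) ⟩
  x 0 + (∑ q middle + x p) - x 0 - x p     ≡⟨ cong (λ s → s - x 0 - x p) expand ⟨
  transform (+ 1) p x 0 - x 0 - x p        ∎
  where
  open ≡-Reasoning
  p = suc q
  middle upper : ℕ → ℤ
  middle i = + (p C suc i) * x (suc i)
  upper i = binomial (+ 1) p (suc i) * x (suc i ℕ.+ 0)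
  expand : transform (+ 1) p x 0 ≡ x 0 + (∑ q middle + x p)
  expand = cong₂ _+_ first (trans (∑-last q upper) (cong₂ _+_ (∑-cong q term) last))
    where
    first : binomial (+ 1) p 0 * x 0 ≡ x 0
    first = trans (cong (_* x 0) (trans (binomial-zero (+ 1) p) (ℤP.^-zeroˡ p))) (ℤP.*-identityˡ (x 0))
    term : ∀ i → upper i ≡ middle i
    term i = cong₂ _*_ (binomial-one p (suc i)) (cong (x ∘ suc) (ℕP.+-identityʳ i))
    last : upper q ≡ x p
    last = trans (cong₂ _*_ (binomial-diag (+ 1) p) (cong x (ℕP.+-identityʳ p))) (ℤP.*-identityˡ (x p))
  isolate : ∀ a s b → s ≡ a + (s + b) - a - b
  isolate = solve-∀

-- Euler's criterion

eval : ∀ {n} → Vec ℤ n → ℤ → ℤ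
eval []       x = + 0
eval (c ∷ cs) x = c + x * eval cs x

leading : ∀ {n} → Vec ℤ (suc n) → ℤ
leading (c ∷ [])     = c
leading (c ∷ d ∷ ds) = leading (d ∷ ds)

leading-∷ : ∀ {n} c (cs : Vec ℤ (suc n)) → leading (c ∷ cs) ≡ leading cs
leading-∷ c (d ∷ ds) = refl

deflate : ∀ {n} → Vec ℤ (suc (suc n)) → ℤ → Vec ℤ (suc n)
deflate (c ∷ d ∷ [])     r = d ∷ []
deflate (c ∷ d ∷ e ∷ es) r = eval (d ∷ e ∷ es) r ∷ deflate (d ∷ e ∷ es) r

eval-deflate : ∀ {n} (f : Vec ℤ (suc (suc n))) r x → eval f x ≡ eval f r + (x - r) * eval (deflate f r) x
eval-deflate (c ∷ d ∷ [])     r x = linear c d x r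
  where
  linear : ∀ c d x r → c + x * (d + x * + 0) ≡ (c + r * (d + r * + 0)) + (x - r) * (d + x * + 0)
  linear = solve-∀
eval-deflate (c ∷ d ∷ e ∷ es) r x =
  trans (cong (λ y → c + x * y) (eval-deflate (d ∷ e ∷ es) r x))
        (step c x r (eval (d ∷ e ∷ es) r) (eval (deflate (d ∷ e ∷ es) r) x))
  where
  step : ∀ c x r g q → c + x * (g + (x - r) * q) ≡ (c + r * g) + (x - r) * (g + x * q)
  step = solve-∀

leading-deflate : ∀ {n} (f : Vec ℤ (suc (suc n))) r → leading (deflate f r) ≡ leading f
leading-deflate (c ∷ d ∷ [])     r = refl
leading-deflate (c ∷ d ∷ e ∷ es) r =
  trans (leading-∷ _ (deflate (d ∷ e ∷ es) r)) (leading-deflate (d ∷ e ∷ es) r)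

module _ {p} (pp : Prime p) where

  lagrange : ∀ n (f : Vec ℤ (suc n)) (ρ : ℕ → ℤ) →
             (∀ {i j} → i ≤ n → j < i → ¬ + p ∣ ρ i - ρ j) →
             (∀ {i} → i ≤ n → + p ∣ eval f (ρ i)) →
             + p ∣ leading f
  lagrange zero (c ∷ []) ρ distinct roots =
    subst (+ p ∣_) (ℤP.+-identityʳ c) (subst (λ y → + p ∣ c + y) (ℤP.*-zeroʳ (ρ 0)) (roots z≤n))
  lagrange (suc n) f ρ distinct roots =
    subst (+ p ∣_) (leading-deflate f r)
      (lagrange n (deflate f r) ρ (λ i≤n → distinct (ℕP.m≤n⇒m≤1+n i≤n)) quotient-roots)
    where
    r = ρ (suc n)
    quotient-roots : ∀ {i} → i ≤ n → + p ∣ eval (deflate f r) (ρ i)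
    quotient-roots {i} i≤n = prime∣*-cancelˡ pp ρᵢ≢r
      (∣m+n∣m⇒∣n (subst (+ p ∣_) (eval-deflate f r (ρ i)) (roots (ℕP.m≤n⇒m≤1+n i≤n))) (roots ℕP.≤-refl))
      where
      ρᵢ≢r : ¬ + p ∣ ρ i - r
      ρᵢ≢r p∣ρᵢ-r = distinct ℕP.≤-refl (s≤s i≤n) (subst (+ p ∣_) (negate (ρ i) r) (∣m⇒∣-m p∣ρᵢ-r))
        where
        negate : ∀ a b → - (a - b) ≡ b - a
        negate = solve-∀

monomial : ∀ n → Vec ℤ (suc n)
monomial zero    = + 1 ∷ []
monomial (suc n) = + 0 ∷ monomial n

eval-monomial : ∀ n y → eval (monomial n) y ≡ y ^ n
eval-monomial zero    y = cong (_+_ (+ 1)) (ℤP.*-zeroʳ y)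
eval-monomial (suc n) y = trans (ℤP.+-identityˡ _) (cong (y *_) (eval-monomial n y))

leading-monomial : ∀ n → leading (monomial n) ≡ + 1
leading-monomial zero    = refl
leading-monomial (suc n) = trans (leading-∷ (+ 0) (monomial n)) (leading-monomial n)

^-square : ∀ x k → (x * x) ^ k ≡ x ^ (k ℕ.+ k)
^-square x zero    = refl
^-square x (suc k) = begin
  x * x * (x * x) ^ k    ≡⟨ cong (x * x *_) (^-square x k) ⟩
  x * x * x ^ (k ℕ.+ k)  ≡⟨ ℤP.*-assoc x x _ ⟩
  x * (x * x ^ (k ℕ.+ k)) ≡⟨ cong (λ n → x * x ^ n) (ℕP.+-suc k k) ⟨
  x ^ (suc k ℕ.+ suc k)  ∎
  where open ≡-Reasoning

euler-residue : ∀ {k} → Prime (suc (k ℕ.+ k)) → ∀ D x →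
                ¬ + suc (k ℕ.+ k) ∣ D → + suc (k ℕ.+ k) ∣ x * x - D → D ^ k ≡ + 1 [mod suc (k ℕ.+ k) ]
euler-residue {k} pp D x p∤D p∣x²-D = begin
  D ^ k            ≈⟨ ^-cong-mod k (≡-mod-sym (∣⇒≡-mod p∣x²-D)) ⟩
  (x * x) ^ k      ≡⟨ ^-square x k ⟩
  x ^ (k ℕ.+ k)    ≈⟨ fermat-unit pp x p∤x ⟩
  + 1              ∎
  where
  open ≡-mod-Reasoning (suc (k ℕ.+ k))
  p∤x : ¬ + suc (k ℕ.+ k) ∣ x
  p∤x p∣x = p∤D (subst (+ suc (k ℕ.+ k) ∣_) (cancel (x * x) D) (∣m∣n⇒∣m-n (∣m⇒∣m*n x p∣x) p∣x²-D))
    where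
    cancel : ∀ a b → a - (a - b) ≡ b
    cancel = solve-∀

squares-incongruent : ∀ {p} → Prime p → ∀ {i j} → j < i → i ℕ.+ j < p → ¬ + p ∣ + i * + i - + j * + j
squares-incongruent {p} pp {i} {j} j<i i+j<p p∣i²-j² =
  [ p∤i-j , p∤i+j ]′ (euclidsLemmaℤ pp (+ i - + j) (+ i + + j)
                       (subst (+ p ∣_) (difference-of-squares (+ i) (+ j)) p∣i²-j²))
  where
  difference-of-squares : ∀ x y → x * x - y * y ≡ (x - y) * (x + y)
  difference-of-squares = solve-∀
  i-j<p : i ℕ.∸ j < p
  i-j<p = ℕP.≤-<-trans (ℕP.m∸n≤m i j) (ℕP.≤-<-trans (ℕP.m≤m+n i j) i+j<p)
  p∤i-j : ¬ + p ∣ + i - + j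
  p∤i-j = >⇒∤ℤ {{ℕ.>-nonZero (ℕP.m<n⇒0<n∸m j<i)}} i-j<p
          ∘ subst (+ p ∣_) (trans (ℤP.m-n≡m⊖n i j) (ℤP.⊖-≥ (ℕP.<⇒≤ j<i)))
  p∤i+j : ¬ + p ∣ + i + + j
  p∤i+j = >⇒∤ℤ {{ℕ.>-nonZero (ℕP.<-≤-trans (ℕP.≤-<-trans z≤n j<i) (ℕP.m≤m+n i j))}} i+j<p

-- Lagrange applied to Xᵏ − 1, whose roots would include D and the k distinct squares 1², …, k².
nonresidue-pow≢1 : ∀ {k′} → let k = suc k′ ; p = suc (k ℕ.+ k) in Prime p → ∀ D →
                   (∀ x → x < p → ¬ + p ∣ + x * + x - D) → ¬ + p ∣ D ^ k - + 1
nonresidue-pow≢1 {k′} pp D nonresidue p∣Dᵏ-1 =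
  >⇒∤ℤ {p} {1} (s≤s (s≤s z≤n))
    (subst (+ p ∣_) (trans (leading-∷ (- + 1) (monomial k′)) (leading-monomial k′))
      (lagrange pp k f ρ distinct (λ {i} → roots i)))
  where
  k = suc k′
  p = suc (k ℕ.+ k)
  f : Vec ℤ (suc k)
  f = - + 1 ∷ monomial k′
  eval-f : ∀ y → eval f y ≡ y ^ k - + 1
  eval-f y = trans (cong (λ z → - + 1 + y * z) (eval-monomial k′ y)) (ℤP.+-comm (- + 1) (y ^ k))
  ρ : ℕ → ℤ
  ρ zero    = D
  ρ (suc i) = + suc i * + suc i
  i<p : ∀ {i} → i ≤ k → i < p
  i<p i≤k = s≤s (ℕP.≤-trans i≤k (ℕP.m≤m+n k k))
  distinct : ∀ {i j} → i ≤ k → j < i → ¬ + p ∣ ρ i - ρ j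
  distinct {suc i} {zero}  i≤k _   = nonresidue (suc i) (i<p i≤k)
  distinct {suc i} {suc j} i≤k j<i =
    squares-incongruent pp j<i (s≤s (ℕP.+-mono-≤ i≤k (ℕP.≤-trans (ℕP.<⇒≤ j<i) i≤k)))
  roots : ∀ i → i ≤ k → + p ∣ eval f (ρ i)
  roots zero    _   = subst (+ p ∣_) (sym (eval-f D)) p∣Dᵏ-1
  roots (suc i) i≤k =
    subst (+ p ∣_) (sym (trans (eval-f (ρ (suc i))) (cong (_- + 1) (^-square (+ suc i) k))))
      (≡-mod⇒∣ (fermat-unit pp (+ suc i) (>⇒∤ℤ (i<p i≤k))))

euler-nonresidue : ∀ {k} → Prime (suc (k ℕ.+ k)) → ∀ D → ¬ + suc (k ℕ.+ k) ∣ D →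
                   (∀ x → x < suc (k ℕ.+ k) → ¬ + suc (k ℕ.+ k) ∣ + x * + x - D) →
                   D ^ k ≡ - + 1 [mod suc (k ℕ.+ k) ]
euler-nonresidue {zero}  pp = contradiction pp ¬prime[1]
euler-nonresidue {k@(suc k′)} pp D p∤D nonresidue =
  ∣⇒≡-mod (subst (+ p ∣_) (plus-minus (D ^ k))
    (prime∣*-cancelˡ pp (nonresidue-pow≢1 pp D nonresidue)
      (subst (+ p ∣_) (factor D k) (≡-mod⇒∣ (fermat-unit pp D p∤D)))))
  where
  p = suc (k ℕ.+ k)
  plus-minus : ∀ y → y + + 1 ≡ y - - + 1
  plus-minus = solve-∀
  factor : ∀ D k → D ^ (k ℕ.+ k) - + 1 ≡ (D ^ k - + 1) * (D ^ k + + 1)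
  factor D k = trans (cong (_- + 1) (ℤP.^-distribˡ-+-* D k k)) (difference-of-squares (D ^ k))
    where
    difference-of-squares : ∀ y → y * y - + 1 ≡ (y - + 1) * (y + + 1)
    difference-of-squares = solve-∀

legendre-cases : ∀ D p → ¬ + p ∣ D →
                 (legendre D p ≡ + 1 × ∃[ x ] + p ∣ + x * + x - D)
               ⊎ (legendre D p ≡ - + 1 × ∀ x → x < p → ¬ + p ∣ + x * + x - D)
legendre-cases D p p∤D with p ℕD.∣? ℤ.∣ D ∣
... | yes p∣D = contradiction (∣ᵤ⇒∣ p∣D) p∤D
... | no _ with isQR D p in qr
...   | true  = inj₁ (refl , residue (subst T (sym qr) _))
  where
  residue : T (isQR D p) → ∃[ x ] + p ∣ + x * + x - D
  residue isqr with applyUpTo⁻ id (any⁻ (λ x → p ∣ℤ? (+ x * + x - D)) (upTo p) isqr)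
  ... | x , _ , p∣x²-D = x , ∣ᵤ⇒∣ (toWitness p∣x²-D)
...   | false = inj₂ (refl , nonresidue)
  where
  nonresidue : ∀ x → x < p → ¬ + p ∣ + x * + x - D
  nonresidue x x<p p∣x²-D =
    subst T qr (any⁺ (λ x → p ∣ℤ? (+ x * + x - D)) (applyUpTo⁺ id (fromWitness (∣⇒∣ᵤ p∣x²-D)) x<p))

-- Lucas sequences

-- Defs computes u and v by a private recursion on pairs of consecutive terms.  The meta lucasPair
-- is solved to that function by unifying with the unfolding of u (the with-abstraction makes this
-- a pattern problem), so that the recurrence can be proved for arbitrary initial values.
private
  mutual
    lucasPair : ℤ → ℤ → ℤ → ℤ → ℕ → ℤ
    lucasPair = _

    lucasPair-u : ∀ A B n → lucasPair A B (+ 0) (+ 1) n ≡ u A B n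
    lucasPair-u A B n with + 0 | + 1
    ... | x | y = refl

  lucasPair-rec : ∀ A B x y n →
    lucasPair A B x y (suc (suc n)) ≡ A * lucasPair A B x y (suc n) - B * lucasPair A B x y n
  lucasPair-rec A B x y zero    = refl
  lucasPair-rec A B x y (suc n) = lucasPair-rec A B y (A * y - B * x) n

u-rec : ∀ A B n → u A B (suc (suc n)) ≡ A * u A B (suc n) - B * u A B n
u-rec A B = lucasPair-rec A B (+ 0) (+ 1)

v-rec : ∀ A B n → v A B (suc (suc n)) ≡ A * v A B (suc n) - B * v A B n
v-rec A B = lucasPair-rec A B (+ 2) A

LucasRec : ℤ → (ℕ → ℤ) → Set
LucasRec A x = ∀ n → x (suc (suc n)) ≡ A * x (suc n) - x n

lucasRec-u : ∀ A → LucasRec A (u A (+ 1))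
lucasRec-u A n = trans (u-rec A (+ 1) n) (cong (λ y → A * u A (+ 1) (suc n) - y) (ℤP.*-identityˡ _))

lucasRec-v : ∀ A → LucasRec A (v A (+ 1))
lucasRec-v A n = trans (v-rec A (+ 1) n) (cong (λ y → A * v A (+ 1) (suc n) - y) (ℤP.*-identityˡ _))

lucasRec-unique : ∀ {A x y} → LucasRec A x → LucasRec A y → x 0 ≡ y 0 → x 1 ≡ y 1 → ∀ n → x n ≡ y n
lucasRec-unique {A} {x} {y} recx recy x₀ x₁ n = proj₁ (pairs n)
  where
  pairs : ∀ n → x n ≡ y n × x (suc n) ≡ y (suc n)
  pairs zero    = x₀ , x₁
  pairs (suc n) with pairs n
  ... | xₙ , xₙ₊₁ = xₙ₊₁ , trans (recx n) (trans (cong₂ (λ s t → A * s - t) xₙ₊₁ xₙ) (sym (recy n)))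

module Lucas (A : ℤ) where

  U V : ℕ → ℤ
  U = u A (+ 1)
  V = v A (+ 1)

  V≡2U′-AU : ∀ n → V n ≡ + 2 * U (suc n) - A * U n
  V≡2U′-AU = lucasRec-unique {A} {V} {λ n → + 2 * U (suc n) - A * U n} (lucasRec-v A) rec (init₀ A) (init₁ A)
    where
    rec : LucasRec A (λ n → + 2 * U (suc n) - A * U n)
    rec n rewrite lucasRec-u A (suc n) | lucasRec-u A n = shift A (U n) (U (suc n))
      where
      shift : ∀ A a b → + 2 * (A * (A * b - a) - b) - A * (A * b - a) ≡
                        A * (+ 2 * (A * b - a) - A * b) - (+ 2 * b - A * a)
      shift = solve-∀
    init₀ : ∀ A → + 2 ≡ + 2 * + 1 - A * + 0
    init₀ = solve-∀
    init₁ : ∀ A → A ≡ + 2 * (A * + 1 - + 1 * + 0) - A * + 1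
    init₁ = solve-∀

  cassini : ∀ n → U (suc n) * U (suc n) - A * U n * U (suc n) + U n * U n ≡ + 1
  cassini zero    = solve₀ A
    where
    solve₀ : ∀ A → + 1 * + 1 - A * + 0 * + 1 + + 0 * + 0 ≡ + 1
    solve₀ = solve-∀
  cassini (suc n) rewrite lucasRec-u A n = trans (step A (U n) (U (suc n))) (cassini n)
    where
    step : ∀ A a b → (A * b - a) * (A * b - a) - A * b * (A * b - a) + b * b ≡ b * b - A * a * b + a * a
    step = solve-∀

  u-+ : ∀ m n → U (suc (m ℕ.+ n)) ≡ U (suc m) * U (suc n) - U m * U n
  u-+ zero          n = base₀ (U (suc n)) (U n)
    where
    base₀ : ∀ x y → x ≡ + 1 * x - + 0 * y
    base₀ = solve-∀
  u-+ (suc zero)    n = trans (lucasRec-u A n) (base₁ A (U (suc n)) (U n))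
    where
    base₁ : ∀ A x y → A * x - y ≡ (A * + 1 - + 1 * + 0) * x - + 1 * y
    base₁ = solve-∀
  u-+ (suc (suc m)) n = begin
    U (suc (suc (suc (m ℕ.+ n))))
      ≡⟨ lucasRec-u A (suc (m ℕ.+ n)) ⟩
    A * U (suc (suc m ℕ.+ n)) - U (suc (m ℕ.+ n))
      ≡⟨ cong₂ (λ s t → A * s - t) (u-+ (suc m) n) (u-+ m n) ⟩
    A * (U (suc (suc m)) * U (suc n) - U (suc m) * U n) - (U (suc m) * U (suc n) - U m * U n)
      ≡⟨ cong (λ c → A * (c * U (suc n) - U (suc m) * U n) - (U (suc m) * U (suc n) - U m * U n)) (lucasRec-u A m) ⟩
    A * ((A * U (suc m) - U m) * U (suc n) - U (suc m) * U n) - (U (suc m) * U (suc n) - U m * U n)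
      ≡⟨ regroup A (U m) (U (suc m)) (U (suc n)) (U n) ⟩
    (A * (A * U (suc m) - U m) - U (suc m)) * U (suc n) - (A * U (suc m) - U m) * U n
      ≡⟨ cong₂ (λ c d → (A * c - U (suc m)) * U (suc n) - d * U n) (lucasRec-u A m) (lucasRec-u A m) ⟨
    (A * U (suc (suc m)) - U (suc m)) * U (suc n) - U (suc (suc m)) * U n
      ≡⟨ cong (λ c → c * U (suc n) - U (suc (suc m)) * U n) (lucasRec-u A (suc m)) ⟨
    U (suc (suc (suc m))) * U (suc n) - U (suc (suc m)) * U n ∎
    where
    open ≡-Reasoning
    regroup : ∀ A a b x y → A * ((A * b - a) * x - b * y) - (b * x - a * y) ≡
                            (A * (A * b - a) - b) * x - (A * b - a) * y
    regroup = solve-∀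

  u-double : ∀ n → U (n ℕ.+ n) ≡ U n * V n
  u-double zero    = refl
  u-double (suc n) = begin
    U (suc (n ℕ.+ suc n))                              ≡⟨ u-+ n (suc n) ⟩
    U (suc n) * U (suc (suc n)) - U n * U (suc n)      ≡⟨ cong (λ c → U (suc n) * c - U n * U (suc n)) (lucasRec-u A n) ⟩
    U (suc n) * (A * U (suc n) - U n) - U n * U (suc n) ≡⟨ regroup A (U n) (U (suc n)) ⟩
    U (suc n) * (+ 2 * (A * U (suc n) - U n) - A * U (suc n)) ≡⟨ cong (λ c → U (suc n) * (+ 2 * c - A * U (suc n))) (lucasRec-u A n) ⟨
    U (suc n) * (+ 2 * U (suc (suc n)) - A * U (suc n)) ≡⟨ cong (U (suc n) *_) (V≡2U′-AU (suc n)) ⟨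
    U (suc n) * V (suc n)                               ∎
    where
    open ≡-Reasoning
    regroup : ∀ A a b → b * (A * b - a) - a * b ≡ b * (+ 2 * (A * b - a) - A * b)
    regroup = solve-∀

transform-one-suc : ∀ n x j → transform (+ 1) (suc n) x j ≡ transform (+ 1) n x j + transform (+ 1) n x (suc j)
transform-one-suc n x j =
  trans (transform-suc (+ 1) n x j) (cong (_+ transform (+ 1) n x (suc j)) (ℤP.*-identityˡ (transform (+ 1) n x j)))

transform-one-suc-inner : ∀ n x j → transform (+ 1) (suc n) x j ≡ transform (+ 1) n (λ i → x i + x (suc i)) j
transform-one-suc-inner n x j = begin
  transform (+ 1) (suc n) x j                                   ≡⟨ transform-one-suc n x j ⟩
  transform (+ 1) n x j + transform (+ 1) n x (suc j)           ≡⟨ cong (_+_ (transform (+ 1) n x j)) (transform-shift (+ 1) n x j) ⟨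
  transform (+ 1) n x j + transform (+ 1) n (x ∘ suc) j         ≡⟨ transform-+ (+ 1) n x (x ∘ suc) j ⟨
  transform (+ 1) n (λ i → x i + x (suc i)) j                   ∎
  where open ≡-Reasoning

-- On solutions of the recurrence E² = A E − 1, hence (1 + E)² = (A + 2) E.
transform-one-even : ∀ m n {x} → LucasRec (m - + 2) x → ∀ j → transform (+ 1) (n ℕ.+ n) x j ≡ m ^ n * x (j ℕ.+ n)
transform-one-even m zero    {x} rec j = trans (unit (x j)) (cong (λ i → + 1 * x i) (sym (ℕP.+-identityʳ j)))
  where
  unit : ∀ y → + 1 * y + + 0 ≡ + 1 * y
  unit = solve-∀
transform-one-even m (suc n) {x} rec j = begin
  transform (+ 1) (suc n ℕ.+ suc n) x j
    ≡⟨ cong (λ N → transform (+ 1) (suc N) x j) (ℕP.+-suc n n) ⟩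
  transform (+ 1) (suc (suc (n ℕ.+ n))) x j
    ≡⟨ trans (transform-one-suc-inner (suc (n ℕ.+ n)) x j) (transform-one-suc-inner (n ℕ.+ n) (λ i → x i + x (suc i)) j) ⟩
  transform (+ 1) (n ℕ.+ n) (λ i → (x i + x (suc i)) + (x (suc i) + x (suc (suc i)))) j
    ≡⟨ transform-cong (+ 1) (n ℕ.+ n) square j ⟩
  transform (+ 1) (n ℕ.+ n) (λ i → m * x (suc i)) j
    ≡⟨ transform-*ˡ (+ 1) (n ℕ.+ n) m (x ∘ suc) j ⟩
  m * transform (+ 1) (n ℕ.+ n) (x ∘ suc) j
    ≡⟨ cong (m *_) (transform-one-even m n (rec ∘ suc) j) ⟩
  m * (m ^ n * x (suc (j ℕ.+ n)))
    ≡⟨ trans (sym (ℤP.*-assoc m (m ^ n) _)) (cong (λ i → m ^ suc n * x i) (sym (ℕP.+-suc j n))) ⟩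
  m ^ suc n * x (j ℕ.+ suc n) ∎
  where
  open ≡-Reasoning
  collapse : ∀ m a b → (a + b) + (b + ((m - + 2) * b - a)) ≡ m * b
  collapse = solve-∀
  square : ∀ i → (x i + x (suc i)) + (x (suc i) + x (suc (suc i))) ≡ m * x (suc i)
  square i = trans (cong (λ z → (x i + x (suc i)) + (x (suc i) + z)) (rec i)) (collapse m (x i) (x (suc i)))

transform-one-odd : ∀ m n {x} → LucasRec (m - + 2) x → ∀ j →
                    transform (+ 1) (suc (n ℕ.+ n)) x j ≡ m ^ n * (x (j ℕ.+ n) + x (suc (j ℕ.+ n)))
transform-one-odd m n {x} rec j =
  trans (transform-one-suc (n ℕ.+ n) x j)
        (trans (cong₂ _+_ (transform-one-even m n rec j) (transform-one-even m n rec (suc j)))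
               (sym (ℤP.*-distribˡ-+ (m ^ n) _ _)))

module LucasExpansion (A : ℤ) where

  open Lucas A

  D : ℤ
  D = A * A - + 4

  -- R n is √Dⁿ⁻¹ for odd n and 0 for even n, so the two expansions below are
  -- (A + √D)ⁿ = 2ⁿ (Vₙ + Uₙ √D) / 2 split into rational and irrational parts.
  R : ℕ → ℤ
  R = u (+ 0) (- D)

  R-rec : ∀ n → R (suc (suc n)) ≡ D * R n
  R-rec n = trans (u-rec (+ 0) (- D) n) (simplify D (R (suc n)) (R n))
    where
    simplify : ∀ D x y → + 0 * x - (- D) * y ≡ D * y
    simplify = solve-∀

  R-even : ∀ n → R (n ℕ.+ n) ≡ + 0
  R-even zero    = refl
  R-even (suc n) = begin
    R (suc (n ℕ.+ suc n))  ≡⟨ cong (R ∘ suc) (ℕP.+-suc n n) ⟩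
    R (suc (suc (n ℕ.+ n))) ≡⟨ R-rec (n ℕ.+ n) ⟩
    D * R (n ℕ.+ n)         ≡⟨ cong (D *_) (R-even n) ⟩
    D * + 0                 ≡⟨ ℤP.*-zeroʳ D ⟩
    + 0                     ∎
    where open ≡-Reasoning

  R-odd : ∀ n → R (suc (n ℕ.+ n)) ≡ D ^ n
  R-odd zero    = refl
  R-odd (suc n) = begin
    R (suc (suc (n ℕ.+ suc n)))  ≡⟨ cong (R ∘ suc ∘ suc) (ℕP.+-suc n n) ⟩
    R (suc (suc (suc (n ℕ.+ n)))) ≡⟨ R-rec (suc (n ℕ.+ n)) ⟩
    D * R (suc (n ℕ.+ n))         ≡⟨ cong (D *_) (R-odd n) ⟩
    D * D ^ n                      ∎
    where open ≡-Reasoning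

  transform-R-shift : ∀ n j → transform A n R (suc (suc j)) ≡ D * transform A n R j
  transform-R-shift n j = begin
    transform A n R (suc (suc j))            ≡⟨ trans (transform-shift A n (R ∘ suc) j) (transform-shift A n R (suc j)) ⟨
    transform A n (R ∘ suc ∘ suc) j          ≡⟨ transform-cong A n R-rec j ⟩
    transform A n (λ i → D * R i) j          ≡⟨ transform-*ˡ A n D R j ⟩
    D * transform A n R j                    ∎
    where open ≡-Reasoning

  expansion : ∀ n → + 2 * transform A n R 0 ≡ (+ 2) ^ n * U n × + 2 * transform A n R 1 ≡ (+ 2) ^ n * V n
  expansion zero    = refl , refl
  expansion (suc n) = expansion-U , expansion-V
    where
    open ≡-Reasoning
    Tₙ = transform A n R
    expansion-U : + 2 * transform A (suc n) R 0 ≡ (+ 2) ^ suc n * U (suc n)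
    expansion-U = begin
      + 2 * transform A (suc n) R 0           ≡⟨ cong (+ 2 *_) (transform-suc A n R 0) ⟩
      + 2 * (A * Tₙ 0 + Tₙ 1)                   ≡⟨ distrib A (Tₙ 0) (Tₙ 1) ⟩
      A * (+ 2 * Tₙ 0) + + 2 * Tₙ 1             ≡⟨ cong₂ (λ s t → A * s + t) (proj₁ (expansion n)) (proj₂ (expansion n)) ⟩
      A * ((+ 2) ^ n * U n) + (+ 2) ^ n * V n     ≡⟨ cong (λ w → A * ((+ 2) ^ n * U n) + (+ 2) ^ n * w) (V≡2U′-AU n) ⟩
      A * ((+ 2) ^ n * U n) + (+ 2) ^ n * (+ 2 * U (suc n) - A * U n) ≡⟨ collect A ((+ 2) ^ n) (U n) (U (suc n)) ⟩
      (+ 2) ^ suc n * U (suc n)                 ∎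
      where
      distrib : ∀ A s t → + 2 * (A * s + t) ≡ A * (+ 2 * s) + + 2 * t
      distrib = solve-∀
      collect : ∀ A P a b → A * (P * a) + P * (+ 2 * b - A * a) ≡ + 2 * P * b
      collect = solve-∀
    expansion-V : + 2 * transform A (suc n) R 1 ≡ (+ 2) ^ suc n * V (suc n)
    expansion-V = begin
      + 2 * transform A (suc n) R 1           ≡⟨ cong (+ 2 *_) (trans (transform-suc A n R 1) (cong (_+_ (A * Tₙ 1)) (transform-R-shift n 0))) ⟩
      + 2 * (A * Tₙ 1 + D * Tₙ 0)               ≡⟨ distrib A D (Tₙ 0) (Tₙ 1) ⟩
      A * (+ 2 * Tₙ 1) + D * (+ 2 * Tₙ 0)       ≡⟨ cong₂ (λ s t → A * s + D * t) (proj₂ (expansion n)) (proj₁ (expansion n)) ⟩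
      A * ((+ 2) ^ n * V n) + D * ((+ 2) ^ n * U n) ≡⟨ cong (λ w → A * ((+ 2) ^ n * w) + D * ((+ 2) ^ n * U n)) (V≡2U′-AU n) ⟩
      A * ((+ 2) ^ n * (+ 2 * U (suc n) - A * U n)) + D * ((+ 2) ^ n * U n) ≡⟨ collect A ((+ 2) ^ n) (U n) (U (suc n)) ⟩
      + 2 * (+ 2) ^ n * (+ 2 * (A * U (suc n) - U n) - A * U (suc n)) ≡⟨ cong (λ c → + 2 * (+ 2) ^ n * (+ 2 * c - A * U (suc n))) (lucasRec-u A n) ⟨
      (+ 2) ^ suc n * (+ 2 * U (suc (suc n)) - A * U (suc n)) ≡⟨ cong ((+ 2) ^ suc n *_) (V≡2U′-AU (suc n)) ⟨
      (+ 2) ^ suc n * V (suc n)                 ∎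
      where
      distrib : ∀ A D s t → + 2 * (A * t + D * s) ≡ A * (+ 2 * t) + D * (+ 2 * s)
      distrib = solve-∀
      collect : ∀ A P a b → A * (P * (+ 2 * b - A * a)) + (A * A - + 4) * (P * a) ≡ + 2 * P * (+ 2 * (A * b - a) - A * b)
      collect = solve-∀

module LucasModPrime {k : ℕ} (pp : Prime (suc (k ℕ.+ k))) (A : ℤ) where

  open Lucas A
  open LucasExpansion A

  private
    p = suc (k ℕ.+ k)

  u-prime : U p ≡ D ^ k [mod p ]
  u-prime = *-cancelˡ-mod pp (+ 2) (odd-prime∤2 {k} pp) (begin
    + 2 * U p                          ≈⟨ *-congʳ-mod (U p) (fermat pp (+ 2)) ⟨
    (+ 2) ^ p * U p                    ≡⟨ proj₁ (expansion p) ⟨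
    + 2 * transform A p R 0            ≈⟨ *-congˡ-mod (+ 2) (transform-prime A R 0 pp) ⟩
    + 2 * (A ^ p * + 0 + R (p ℕ.+ 0))  ≡⟨ cong (λ r → + 2 * (A ^ p * + 0 + r)) (trans (cong R (ℕP.+-identityʳ p)) (R-odd k)) ⟩
    + 2 * (A ^ p * + 0 + D ^ k)        ≡⟨ cong (λ r → + 2 * (r + D ^ k)) (ℤP.*-zeroʳ (A ^ p)) ⟩
    + 2 * (+ 0 + D ^ k)                ≡⟨ cong (+ 2 *_) (ℤP.+-identityˡ (D ^ k)) ⟩
    + 2 * D ^ k                        ∎)
    where open ≡-mod-Reasoning p

  v-prime : V p ≡ A [mod p ]
  v-prime = *-cancelˡ-mod pp (+ 2) (odd-prime∤2 {k} pp) (begin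
    + 2 * V p                          ≈⟨ *-congʳ-mod (V p) (fermat pp (+ 2)) ⟨
    (+ 2) ^ p * V p                    ≡⟨ proj₂ (expansion p) ⟨
    + 2 * transform A p R 1            ≈⟨ *-congˡ-mod (+ 2) (transform-prime A R 1 pp) ⟩
    + 2 * (A ^ p * + 1 + R (p ℕ.+ 1))  ≡⟨ cong (λ r → + 2 * (A ^ p * + 1 + r)) R-even-p+1 ⟩
    + 2 * (A ^ p * + 1 + + 0)          ≡⟨ cong (+ 2 *_) (trans (ℤP.+-identityʳ _) (ℤP.*-identityʳ (A ^ p))) ⟩
    + 2 * A ^ p                        ≈⟨ *-congˡ-mod (+ 2) (fermat pp A) ⟩
    + 2 * A                            ∎)
    where
    open ≡-mod-Reasoning p
    R-even-p+1 : R (p ℕ.+ 1) ≡ + 0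
    R-even-p+1 = trans (cong (R ∘ suc) (trans (ℕP.+-comm (k ℕ.+ k) 1) (sym (ℕP.+-suc k k)))) (R-even (suc k))

-- The congruences modulo p²

∣-square-form : ∀ {P x y C} α β γ δ → P ∣ x → P ∣ y → C ≡ + 1 →
                P * P ∣ α * (x * x) + β * (x * y) + γ * (y * y) + δ * (C - + 1)
∣-square-form {P} {x} {y} α β γ δ P∣x P∣y refl =
  ∣m∣n⇒∣m+n (∣m∣n⇒∣m+n (∣m∣n⇒∣m+n (∣n⇒∣m*n α (product P∣x P∣x)) (∣n⇒∣m*n β (product P∣x P∣y)))
                       (∣n⇒∣m*n γ (product P∣y P∣y)))
            (∣n⇒∣m*n δ (divides (+ 0) (sym (ℤP.*-zeroˡ (P * P)))))
  where
  product : ∀ {u v} → P ∣ u → P ∣ v → P * P ∣ u * v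
  product {u} P∣u P∣v = ∣-trans (*-monoˡ-∣ P P∣u) (*-monoʳ-∣ u P∣v)

module _ {p} (pp : Prime p) (p∤2 : ¬ + p ∣ + 2) (A a b X : ℤ)
         (cassini : b * b - A * a * b + a * a ≡ + 1) (p∣ab : + p ∣ a * b)
         (p∣X[a+b]-Uₚ : + p ∣ X * (a + b) - (b * b - a * a)) where

  private
    p∣C-1 : + p ∣ b * b - A * a * b + a * a - + 1
    p∣C-1 = subst (λ c → + p ∣ c - + 1) (sym cassini) (divides (+ 0) refl)

    two⁺ : ∀ A a b → + 2 ≡ b * (+ 2 * b - A * a) - (b * b - a * a - + 1) - (b * b - A * a * b + a * a - + 1)
    two⁺ = solve-∀

    two⁻ : ∀ A a b → + 2 ≡ (b * b - a * a + + 1) - (b * b - A * a * b + a * a - + 1) + (+ 2 * a - A * b) * a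
    two⁻ = solve-∀

    X-b : ∀ a b X → X - b ≡ (b - X) * (b * b - a * a - + 1) + b * (X * (a + b) - (b * b - a * a)) - X * a * (a + b)
    X-b = solve-∀

    X+a : ∀ a b X → X + a ≡ (X + a) * (b * b - a * a + + 1) + a * (X * (a + b) - (b * b - a * a)) - X * b * (a + b)
    X+a = solve-∀

  residue-case : + p ∣ b * b - a * a - + 1 → + p ∣ a × + p ∣ X - b
  residue-case p∣Uₚ-1 with euclidsLemmaℤ pp a b p∣ab
  ... | inj₂ p∣b = contradiction (subst (+ p ∣_) (sym (two⁺ A a b))
                     (∣m∣n⇒∣m-n (∣m∣n⇒∣m-n (∣m⇒∣m*n (+ 2 * b - A * a) p∣b) p∣Uₚ-1) p∣C-1)) p∤2
  ... | inj₁ p∣a = p∣a , subst (+ p ∣_) (sym (X-b a b X))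
                     (∣m∣n⇒∣m-n (∣m∣n⇒∣m+n (∣n⇒∣m*n (b - X) p∣Uₚ-1) (∣n⇒∣m*n b p∣X[a+b]-Uₚ))
                                (∣m⇒∣m*n (a + b) (∣n⇒∣m*n X p∣a)))

  nonresidue-case : + p ∣ b * b - a * a + + 1 → + p ∣ b × + p ∣ X + a
  nonresidue-case p∣Uₚ+1 with euclidsLemmaℤ pp a b p∣ab
  ... | inj₁ p∣a = contradiction (subst (+ p ∣_) (sym (two⁻ A a b))
                     (∣m∣n⇒∣m+n (∣m∣n⇒∣m-n p∣Uₚ+1 p∣C-1) (∣n⇒∣m*n (+ 2 * a - A * b) p∣a))) p∤2
  ... | inj₂ p∣b = p∣b , subst (+ p ∣_) (sym (X+a a b X))
                     (∣m∣n⇒∣m-n (∣m∣n⇒∣m+n (∣n⇒∣m*n (X + a) p∣Uₚ+1) (∣n⇒∣m*n a p∣X[a+b]-Uₚ))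
                                (∣m⇒∣m*n (a + b) (∣n⇒∣m*n X p∣b)))

numerator₁ : ℤ → ℤ → ℤ → ℤ → ℤ → ℤ
numerator₁ m L S F w = + 4 * S - + 2 * L * F - (+ 4 - m) * w

numerator₂ : ℤ → ℤ → ℤ → ℤ → ℤ → ℤ
numerator₂ m L S F w = + 4 * S - + 2 * m * F + m * (m - + 4) * L * w

numerator₁-cong : ∀ {m L S S′ F F′ w w′} → S ≡ S′ → F ≡ F′ → w ≡ w′ → numerator₁ m L S F w ≡ numerator₁ m L S′ F′ w′
numerator₁-cong refl refl refl = refl

numerator₂-cong : ∀ {m L S S′ F F′ w w′} → S ≡ S′ → F ≡ F′ → w ≡ w′ → numerator₂ m L S F w ≡ numerator₂ m L S′ F′ w′
numerator₂-cong refl refl refl = refl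

residue-numerator₁ : ∀ m a b X → let A = m - + 2 in
  + 4 * (X * (a + b) - + 0 - (b * b - a * a)) - + 2 * + 1 * (X * X - + 1) - (+ 4 - m) * (a * (+ 2 * b - A * a))
  ≡ - + 2 * ((X - b) * (X - b)) + + 4 * ((X - b) * a) + (+ 6 + + 2 * A - A * A) * (a * a) + - + 2 * (b * b - A * a * b + a * a - + 1)
residue-numerator₁ = solve-∀
residue-numerator₂ : ∀ m a b X → let A = m - + 2 ; Δ = m * (m - + 4) in
  + 4 * (X * ((+ 2 * b - A * a) + (A * b - + 2 * a)) - + 2 - (+ 2 * (b * (A * b - + 2 * a)) - A * (b * b - a * a)))
    - + 2 * m * (X * X - + 1) + Δ * + 1 * (a * (+ 2 * b - A * a))
  ≡ - + 2 * m * ((X - b) * (X - b)) + - + 4 * m * ((X - b) * a) + - (+ 2 * m + A * Δ) * (a * a)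
    + (+ 4 - + 2 * A) * (b * b - A * a * b + a * a - + 1)
residue-numerator₂ = solve-∀

nonresidue-numerator₁ : ∀ m a b X → let A = m - + 2 in
  + 4 * (X * (a + b) - + 0 - (b * b - a * a)) - + 2 * - + 1 * (X * X - + 1) - (+ 4 - m) * (b * (A * b - + 2 * a))
  ≡ + 2 * ((X + a) * (X + a)) + + 4 * ((X + a) * b) + (A * A - + 2 * A - + 6) * (b * b) + + 2 * (b * b - A * a * b + a * a - + 1)
nonresidue-numerator₁ = solve-∀
nonresidue-numerator₂ : ∀ m a b X → let A = m - + 2 ; Δ = m * (m - + 4) in
  + 4 * (X * ((+ 2 * b - A * a) + (A * b - + 2 * a)) - + 2 - (+ 2 * (b * (A * b - + 2 * a)) - A * (b * b - a * a)))
    - + 2 * m * (X * X - + 1) + Δ * - + 1 * (b * (A * b - + 2 * a))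
  ≡ - + 2 * m * ((X + a) * (X + a)) + + 4 * m * ((X + a) * b) + - (+ 2 * m + A * Δ) * (b * b)
    + (+ 4 - + 2 * A) * (b * b - A * a * b + a * a - + 1)
nonresidue-numerator₂ = solve-∀

numerator-∣ : ∀ {n} (q : ℚ) (r : ℚᵘ) → ℚ.toℚᵘ q ≃ r → ℕC.Coprime n (ℚᵘ.↧ₙ r) → + n ∣ ℚᵘ.↥ r → + n ∣ℤ ↥ q
numerator-∣ {n} q@record{} r (*≡* ↥q↧r≡↥r↧q) n⊥↧r n∣↥r =
  ℤC.coprime-divisor (+ n) (ℚᵘ.↧ r) (↥ q) n⊥↧r
    (∣⇒∣ᵤ (subst (+ n ∣_) (trans (sym ↥q↧r≡↥r↧q) (ℤP.*-comm (↥ q) (ℚᵘ.↧ r))) (∣m⇒∣m*n (↧ q) n∣↥r)))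

toℚᵘ-toℚ : ∀ z → ℚ.toℚᵘ (toℚ z) ≃ mkℚᵘ z 0
toℚᵘ-toℚ z = ℚP.toℚᵘ-fromℚᵘ (mkℚᵘ z 0)

toℚᵘ-/ : ∀ z n → ℚ.toℚᵘ (z ℚ./ suc n) ≃ mkℚᵘ z n
toℚᵘ-/ z n = ℚP.toℚᵘ-fromℚᵘ (mkℚᵘ z n)

module _ {x y : ℚ} {r s : ℚᵘ} (x≃r : ℚ.toℚᵘ x ≃ r) (y≃s : ℚ.toℚᵘ y ≃ s) where

  toℚᵘ-+ : ℚ.toℚᵘ (x ℚ.+ y) ≃ r ℚᵘ.+ s
  toℚᵘ-+ = ℚᵘP.≃-trans (ℚP.toℚᵘ-homo-+ x y) (ℚᵘP.+-cong x≃r y≃s)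

  toℚᵘ-* : ℚ.toℚᵘ (x ℚ.* y) ≃ r ℚᵘ.* s
  toℚᵘ-* = ℚᵘP.≃-trans (ℚP.toℚᵘ-homo-* x y) (ℚᵘP.*-cong x≃r y≃s)

  toℚᵘ-− : ℚ.toℚᵘ (x ℚ.- y) ≃ r ℚᵘ.- s
  toℚᵘ-− = ℚᵘP.≃-trans (ℚP.toℚᵘ-homo-+ x (ℚ.- y)) (ℚᵘP.+-cong x≃r (ℚᵘP.≃-trans (ℚP.toℚᵘ-homo‿- y) (ℚᵘP.-‿cong y≃s)))

difference₁ : ∀ S L F c w →
  ℚ.toℚᵘ (toℚ S ℚ.- (toℚ L ℚ.* (F ℚ./ 2) ℚ.+ (c ℚ./ 4) ℚ.* toℚ w)) ≃ mkℚᵘ (+ 4 * S - + 2 * L * F - c * w) 3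
difference₁ S L F c w =
  ℚᵘP.≃-trans (toℚᵘ-− (toℚᵘ-toℚ S) (toℚᵘ-+ (toℚᵘ-* (toℚᵘ-toℚ L) (toℚᵘ-/ F 1)) (toℚᵘ-* (toℚᵘ-/ c 3) (toℚᵘ-toℚ w))))
              (*≡* (clear S L F c w))
  where
  clear : ∀ S L F c w → (S * + 8 + - (L * F * + 4 + c * w * + 2) * + 1) * + 4 ≡ (+ 4 * S - + 2 * L * F - c * w) * + 8
  clear = solve-∀

difference₂ : ∀ S c F d L w →
  ℚ.toℚᵘ (toℚ S ℚ.- ((c ℚ./ 2) ℚ.* toℚ F ℚ.- (d ℚ./ 4) ℚ.* toℚ L ℚ.* toℚ w)) ≃ mkℚᵘ (+ 4 * S - + 2 * c * F + d * L * w) 3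
difference₂ S c F d L w =
  ℚᵘP.≃-trans (toℚᵘ-− (toℚᵘ-toℚ S) (toℚᵘ-− (toℚᵘ-* (toℚᵘ-/ c 1) (toℚᵘ-toℚ F))
                                           (toℚᵘ-* (toℚᵘ-* (toℚᵘ-/ d 3) (toℚᵘ-toℚ L)) (toℚᵘ-toℚ w))))
              (*≡* (clear S c F d L w))
  where
  clear : ∀ S c F d L w → (S * + 8 + - (c * F * + 4 + - (d * L * w) * + 2) * + 1) * + 4 ≡ (+ 4 * S - + 2 * c * F + d * L * w) * + 8
  clear = solve-∀

congruence₁ : ∀ {n} S L F c w → ℕC.Coprime n 4 → + n ∣ + 4 * S - + 2 * L * F - c * w →
              toℚ S ≡ toℚ L ℚ.* (F ℚ./ 2) ℚ.+ (c ℚ./ 4) ℚ.* toℚ w [modℚ n ]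
congruence₁ S L F c w = numerator-∣ _ _ (difference₁ S L F c w)

congruence₂ : ∀ {n} S c F d L w → ℕC.Coprime n 4 → + n ∣ + 4 * S - + 2 * c * F + d * L * w →
              toℚ S ≡ (c ℚ./ 2) ℚ.* toℚ F ℚ.- (d ℚ./ 4) ℚ.* toℚ L ℚ.* toℚ w [modℚ n ]
congruence₂ S c F d L w = numerator-∣ _ _ (difference₂ S c F d L w)

module LucasSumCongruences {k : ℕ} (pp : Prime (suc (k ℕ.+ k))) (m : ℤ)
                           (p∤Δ : ¬ + suc (k ℕ.+ k) ∣ m * (m - + 4)) where

  private
    p = suc (k ℕ.+ k)
    A = m - + 2
    Δ = m * (m - + 4)

  open Lucas A
  open LucasExpansion A using (D)
  open LucasModPrime {k} pp A

  a b X : ℤ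
  a = U k
  b = U (suc k)
  X = m ^ k

  V-k : V k ≡ + 2 * b - A * a
  V-k = V≡2U′-AU k

  V-k+1 : V (suc k) ≡ A * b - + 2 * a
  V-k+1 = trans (V≡2U′-AU (suc k)) (trans (cong (λ c → + 2 * c - A * b) (lucasRec-u A k)) (simplify A a b))
    where
    simplify : ∀ A a b → + 2 * (A * b - a) - A * b ≡ A * b - + 2 * a
    simplify = solve-∀

  U-p-1 : U (k ℕ.+ k) ≡ a * (+ 2 * b - A * a)
  U-p-1 = trans (u-double k) (cong (a *_) V-k)

  U-p : U p ≡ b * b - a * a
  U-p = u-+ k k

  U-p+1 : U (p ℕ.+ 1) ≡ b * (A * b - + 2 * a)
  U-p+1 = trans (cong U p+1≡k+1+k+1) (trans (u-double (suc k)) (cong (b *_) V-k+1))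
    where
    p+1≡k+1+k+1 : p ℕ.+ 1 ≡ suc k ℕ.+ suc k
    p+1≡k+1+k+1 = cong suc (trans (ℕP.+-comm (k ℕ.+ k) 1) (sym (ℕP.+-suc k k)))

  V-p : V p ≡ + 2 * (b * (A * b - + 2 * a)) - A * (b * b - a * a)
  V-p = trans (V≡2U′-AU p) (cong₂ (λ s t → + 2 * s - A * t) (trans (cong U (ℕP.+-comm 1 p)) U-p+1) U-p)

  sum-U : sumFromTo 1 (p ℕ.∸ 1) (λ j → + (p C j) * U j) ≡ X * (a + b) - + 0 - (b * b - a * a)
  sum-U = trans (sumFromTo-binomial (k ℕ.+ k) U) (cong₂ (λ s t → s - + 0 - t) (transform-one-odd m k (lucasRec-u A) 0) U-p)

  sum-V : sumFromTo 1 (p ℕ.∸ 1) (λ j → + (p C j) * V j) ≡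
          X * ((+ 2 * b - A * a) + (A * b - + 2 * a)) - + 2 - (+ 2 * (b * (A * b - + 2 * a)) - A * (b * b - a * a))
  sum-V = trans (sumFromTo-binomial (k ℕ.+ k) V)
                (cong₂ (λ s t → s - + 2 - t) (trans (transform-one-odd m k (lucasRec-v A) 0) (cong₂ (λ s t → X * (s + t)) V-k V-k+1)) V-p)

  F-eq : m ^ (p ℕ.∸ 1) - + 1 ≡ X * X - + 1
  F-eq = cong (_- + 1) (ℤP.^-distribˡ-+-* m k k)

  p∣X[a+b]-Uₚ : + p ∣ X * (a + b) - (b * b - a * a)
  p∣X[a+b]-Uₚ = ≡-mod⇒∣ (begin
    X * (a + b)                     ≡⟨ transform-one-odd m k (lucasRec-u A) 0 ⟨
    transform (+ 1) p U 0           ≈⟨ transform-prime (+ 1) U 0 pp ⟩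
    (+ 1) ^ p * + 0 + U (p ℕ.+ 0)   ≡⟨ trans (cong₂ _+_ (ℤP.*-zeroʳ ((+ 1) ^ p)) (cong U (ℕP.+-identityʳ p))) (ℤP.+-identityˡ (U p)) ⟩
    U p                             ≡⟨ U-p ⟩
    b * b - a * a                   ∎)
    where open ≡-mod-Reasoning p

  D≡Δ : D ≡ Δ
  D≡Δ = expand m
    where
    expand : ∀ m → (m - + 2) * (m - + 2) - + 4 ≡ m * (m - + 4)
    expand = solve-∀

  p∤2 : ¬ + p ∣ + 2
  p∤2 = odd-prime∤2 {k} pp

  U-p≡Δᵏ : b * b - a * a ≡ Δ ^ k [mod p ]
  U-p≡Δᵏ = subst (λ u → u ≡ Δ ^ k [mod p ]) U-p (subst (λ d → U p ≡ d ^ k [mod p ]) D≡Δ u-prime)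

  p∣ab : + p ∣ a * b
  p∣ab = prime∣*-cancelˡ pp (subst (λ d → ¬ + p ∣ d) (sym D≡Δ) p∤Δ) (∣m+n∣n⇒∣m p∣Dab+AC′ p∣AC′)
    where
    C′ = b * b - A * a * b + a * a - + 1
    p∣AC′ : + p ∣ A * C′
    p∣AC′ = subst (λ c → + p ∣ A * (c - + 1)) (sym (cassini k)) (divides (+ 0) (ℤP.*-zeroʳ A))
    split : ∀ A a b → + 2 * (b * (A * b - + 2 * a)) - A * (b * b - a * a) - A ≡
                      (A * A - + 4) * (a * b) + A * (b * b - A * a * b + a * a - + 1)
    split = solve-∀
    p∣Dab+AC′ : + p ∣ D * (a * b) + A * C′
    p∣Dab+AC′ = subst (+ p ∣_) (trans (cong (_- A) V-p) (split A a b)) (≡-mod⇒∣ v-prime)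

  S₁ S₂ F : ℤ
  S₁ = sumFromTo 1 (p ℕ.∸ 1) (λ j → + (p C j) * U j)
  S₂ = sumFromTo 1 (p ℕ.∸ 1) (λ j → + (p C j) * V j)
  F  = m ^ (p ℕ.∸ 1) - + 1

  Numerators : ℤ → Set
  Numerators L = + (p ℕ.* p) ∣ numerator₁ m L S₁ F (U ℤ.∣ + p - L ∣)
               × + (p ℕ.* p) ∣ numerator₂ m L S₂ F (U ℤ.∣ + p - L ∣)

  private
    p²∣ : ∀ {n f} → n ≡ f → + p * + p ∣ f → + (p ℕ.* p) ∣ n
    p²∣ n≡f = subst₂ _∣_ (sym (ℤP.pos-* p p)) (sym n≡f)

  residue-numerators : + p ∣ a → + p ∣ X - b → Numerators (+ 1)
  residue-numerators p∣a p∣X-b =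
      p²∣ (trans (numerator₁-cong {m} {+ 1} sum-U F-eq U-p-1) (residue-numerator₁ m a b X))
          (∣-square-form (- + 2) (+ 4) (+ 6 + + 2 * A - A * A) (- + 2) p∣X-b p∣a (cassini k))
    , p²∣ (trans (numerator₂-cong {m} {+ 1} sum-V F-eq U-p-1) (residue-numerator₂ m a b X))
          (∣-square-form (- + 2 * m) (- + 4 * m) (- (+ 2 * m + A * Δ)) (+ 4 - + 2 * A) p∣X-b p∣a (cassini k))

  nonresidue-numerators : + p ∣ b → + p ∣ X + a → Numerators (- + 1)
  nonresidue-numerators p∣b p∣X+a =
      p²∣ (trans (numerator₁-cong {m} { - + 1} sum-U F-eq U-p+1) (nonresidue-numerator₁ m a b X))
          (∣-square-form (+ 2) (+ 4) (A * A - + 2 * A - + 6) (+ 2) p∣X+a p∣b (cassini k))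
    , p²∣ (trans (numerator₂-cong {m} { - + 1} sum-V F-eq U-p+1) (nonresidue-numerator₂ m a b X))
          (∣-square-form (- + 2 * m) (+ 4 * m) (- (+ 2 * m + A * Δ)) (+ 4 - + 2 * A) p∣X+a p∣b (cassini k))

  integer-congruences : Numerators (legendre Δ p)
  integer-congruences with legendre-cases Δ p p∤Δ
  ... | inj₁ (L≡1 , x , p∣x²-Δ) =
    subst Numerators (sym L≡1) (uncurry residue-numerators
      (residue-case pp p∤2 A a b X (cassini k) p∣ab p∣X[a+b]-Uₚ
        (≡-mod⇒∣ (≡-mod-trans U-p≡Δᵏ (euler-residue {k} pp Δ (+ x) p∤Δ p∣x²-Δ)))))
  ... | inj₂ (L≡-1 , nonresidue) =
    subst Numerators (sym L≡-1) (uncurry nonresidue-numerators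
      (nonresidue-case pp p∤2 A a b X (cassini k) p∣ab p∣X[a+b]-Uₚ
        (≡-mod⇒∣ (≡-mod-trans U-p≡Δᵏ (euler-nonresidue {k} pp Δ p∤Δ nonresidue)))))

  sum-congruences :
    let L = legendre Δ p ; w = U ℤ.∣ + p - L ∣ in
      (toℚ S₁ ≡ toℚ L ℚ.* (F ℚ./ 2) ℚ.+ ((+ 4 - m) ℚ./ 4) ℚ.* toℚ w [modℚ p ℕ.* p ])
    × (toℚ S₂ ≡ (m ℚ./ 2) ℚ.* toℚ F ℚ.- (Δ ℚ./ 4) ℚ.* toℚ L ℚ.* toℚ w [modℚ p ℕ.* p ])
  sum-congruences =
      congruence₁ S₁ L F (+ 4 - m) w (odd-prime-square⊥4 {k} pp) (proj₁ integer-congruences)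
    , congruence₂ S₂ m F Δ L w (odd-prime-square⊥4 {k} pp) (proj₂ integer-congruences)
    where
    L = legendre Δ p
    w = U ℤ.∣ + p - L ∣

lemma3p3 : (m : ℤ) → m ≢ + 0 → (p : ℕ) → Prime p → p ≢ 2 →
  ¬ ((+ p) ∣ℤ (m ℤ.* (m ℤ.- + 4))) →
  let Δ = m ℤ.* (m ℤ.- + 4)
      L = legendre Δ p
      A = m ℤ.- + 2
      w = u A (+ 1) ℤ.∣ + p ℤ.- L ∣
      F = (m ℤ.^ (p ℕ.∸ 1)) ℤ.- + 1
  in (toℚ (sumFromTo 1 (p ℕ.∸ 1) (λ k → + (p C k) ℤ.* u A (+ 1) k))
        ≡ toℚ L ℚ.* (F ℚ./ 2) ℚ.+ ((+ 4 ℤ.- m) ℚ./ 4) ℚ.* toℚ w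
        [modℚ p ℕ.* p ])
   × (toℚ (sumFromTo 1 (p ℕ.∸ 1) (λ k → + (p C k) ℤ.* v A (+ 1) k))
        ≡ (m ℚ./ 2) ℚ.* toℚ F ℚ.- (Δ ℚ./ 4) ℚ.* toℚ L ℚ.* toℚ w
        [modℚ p ℕ.* p ])
lemma3p3 m _ p pp p≢2 p∤Δ with odd-prime pp p≢2
... | k , refl = LucasSumCongruences.sum-congruences {k} pp m (p∤Δ ∘ ∣⇒∣ᵤ)
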